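{- Suppose that $k\ge 2$, $n\ge r\ge 2$, and $2\le r\le 2k$. Then the minimum size of a contagious set for the $r$-neighbor bootstrap percolation process on $Q_{n,k}$ equals $r$.
   Context: $Q_{n,k}$ is the graph with vertex set $\{0,1\}^n$ in which $x,y$ are adjacent iff $1\le d_H(x,y)\le k$ ($d_H$ = Hamming distance). The $r$-neighbor bootstrap percolation process from $\mathcal{A}_0\subset V$: $\mathcal{A}_i=\mathcal{A}_{i-1}\cup\{v: |N_v\cap\mathcal{A}_{i-1}|\ge r\}$, where $N_v$ is the neighborhood of $v$; it percolates if $\mathcal{A}_i=V$ for some $i$, and then $\mathcal{A}_0$ is called contagious. -}

module Defs where

open import Data.Nat using (ℕ; zero; suc; _+_; _≤_; _≤ᵇ_)
open import Data.Bool using (Bool; true; false; _∧_; _∨_; if_then_else_; _xor_)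
open import Data.Vec using (Vec; []; _∷_)
open import Data.List using (List; []; _∷_; map; _++_; length; filterᵇ)
open import Data.Product using (∃; _×_)
open import Relation.Binary.PropositionalEquality using (_≡_)

Vertex : ℕ → Set
Vertex n = Vec Bool n

allVertices : (n : ℕ) → List (Vertex n)
allVertices zero = [] ∷ []
allVertices (suc n) = map (false ∷_) (allVertices n) ++ map (true ∷_) (allVertices n)

hamming : ∀ {n} → Vertex n → Vertex n → ℕ
hamming [] [] = 0
hamming (a ∷ x) (b ∷ y) = (if a xor b then 1 else 0) + hamming x y

adjacent : ∀ {n} → ℕ → Vertex n → Vertex n → Bool
adjacent k x y = (1 ≤ᵇ hamming x y) ∧ (hamming x y ≤ᵇ k)

VSet : ℕ → Set
VSet n = Vertex n → Bool

size : ∀ {n} → VSet n → ℕ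
size {n} A = length (filterᵇ A (allVertices n))

nbrCount : ∀ {n} → ℕ → VSet n → Vertex n → ℕ
nbrCount {n} k A v = length (filterᵇ (λ u → adjacent k u v ∧ A u) (allVertices n))

step : ∀ {n} → ℕ → ℕ → VSet n → VSet n
step k r A v = A v ∨ (r ≤ᵇ nbrCount k A v)

stage : ∀ {n} → ℕ → ℕ → VSet n → ℕ → VSet n
stage k r A zero = A
stage k r A (suc i) = step k r (stage k r A i)

Contagious : ∀ {n} → ℕ → ℕ → VSet n → Set
Contagious {n} k r A = ∃ λ i → ∀ (v : Vertex n) → stage k r A i v ≡ true

MinContagiousSize : ℕ → ℕ → ℕ → ℕ → Set
MinContagiousSize n k r m =
  (∃ λ (A : VSet n) → Contagious k r A × size A ≡ m)
  × (∀ (A : VSet n) → Contagious k r A → m ≤ size A)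

{-# OPTIONS --safe #-}
-- Lower bound: fewer than r vertices never infect anything new, and r ≤ n < 2ⁿ.
-- Upper bound: for n ≤ k the graph Q_{n,k} is complete, so any r vertices infect everything
-- in one step. Otherwise a contagious set of Q_{m,k} placed on the face x₀ = 0 of Q_{m+1,k}
-- is still contagious: it first infects that face, after which a vertex 1u of the other
-- face sees every 0w with d(w,u) ≤ k−1, i.e. a Hamming ball of radius k−1 in Q_m. For m ≥ k
-- such a ball has at least 2^{k−1} + 2^{k−2} points, which is ≥ 2k ≥ r as soon as k ≥ 3.
-- So r vertices of Q_{k,k} lift all the way to Q_{n,k}. The one exception, k = 2 and r = 4,
-- starts instead from a contagious 4-set of Q_{3,2}, whose radius-1 balls have 4 points.
module Submission where

open import Defs
open import Data.Nat using (ℕ; _≤_; _*_)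
open import Data.Nat.Base
  using (zero; suc; _+_; _∸_; _^_; _⊓_; _<_; _≤ᵇ_; z≤n; s≤s; _≤′_; ≤′-refl; ≤′-step)
open import Data.Nat.Properties
open import Data.Bool.Base using (Bool; true; false; _∧_; _xor_; not; T)
open import Data.Bool.Properties using (T?; T-≡; T-∧; T-∨)
open import Data.Vec.Base using ([]; _∷_)
open import Data.List.Base using (List; []; _∷_; map; _++_; length; filterᵇ)
open import Data.List.Properties using (length-++; filter-++)
open import Data.List.Relation.Binary.Sublist.Propositional using (⊆-refl)
open import Data.List.Relation.Binary.Sublist.Propositional.Properties
  using (filter⁺; length-mono-≤)
open import Data.Product.Base as Product using (∃; _×_; _,_; proj₂)
open import Data.Sum.Base as Sum using (_⊎_; inj₁; inj₂)
open import Function.Base using (_∘_)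
open import Function.Bundles using (Equivalence)
open import Relation.Nullary.Decidable.Core using (yes; no)
open import Relation.Nullary.Negation using (contradiction)
open import Relation.Binary.PropositionalEquality
  using (_≡_; refl; sym; trans; cong; cong₂; subst; module ≡-Reasoning)

open Equivalence using (to; from)

private
  variable
    n m k r s j : ℕ

2^[1+n]≡2^n+2^n : ∀ n → 2 ^ suc n ≡ 2 ^ n + 2 ^ n
2^[1+n]≡2^n+2^n n = cong (2 ^ n +_) (+-identityʳ (2 ^ n))

n<2^n : ∀ n → n < 2 ^ n
n<2^n zero    = s≤s z≤n
n<2^n (suc n) = begin
  suc (suc n)   ≡⟨ +-comm 1 (suc n) ⟩
  suc n + 1     ≤⟨ +-mono-≤ (n<2^n n) (m^n>0 2 n) ⟩
  2 ^ n + 2 ^ n ≡⟨ sym (2^[1+n]≡2^n+2^n n) ⟩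
  2 ^ suc n     ∎
  where open ≤-Reasoning

2k≤2^[k-1]+2^[k-2] : ∀ j → 2 * (3 + j) ≤ 2 ^ (2 + j) + 2 ^ (1 + j)
2k≤2^[k-1]+2^[k-2] j = begin
  2 * (3 + j)
    ≡⟨ *-distribˡ-+ 2 1 (2 + j) ⟩
  2 + 2 * (2 + j)
    ≡⟨ +-comm 2 (2 * (2 + j)) ⟩
  2 * (2 + j) + 2
    ≤⟨ +-mono-≤ (*-monoʳ-≤ 2 (n<2^n (1 + j))) (^-monoʳ-≤ 2 (s≤s (z≤n {j}))) ⟩
  2 * 2 ^ (1 + j) + 2 ^ (1 + j) ∎
  where open ≤-Reasoning

m⊓n+[m∸n]⊓n≡m⊓[n+n] : ∀ m n → m ⊓ n + (m ∸ n) ⊓ n ≡ m ⊓ (n + n)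
m⊓n+[m∸n]⊓n≡m⊓[n+n] m n with ≤-total m n
... | inj₁ m≤n = begin
  m ⊓ n + (m ∸ n) ⊓ n ≡⟨ cong₂ _+_ (m≤n⇒m⊓n≡m m≤n) (cong (_⊓ n) (m≤n⇒m∸n≡0 m≤n)) ⟩
  m + 0               ≡⟨ +-identityʳ m ⟩
  m                   ≡⟨ sym (m≤n⇒m⊓n≡m (≤-trans m≤n (m≤m+n n n))) ⟩
  m ⊓ (n + n)         ∎
  where open ≡-Reasoning
... | inj₂ n≤m = begin
  m ⊓ n + (m ∸ n) ⊓ n     ≡⟨ cong (_+ (m ∸ n) ⊓ n) (m≥n⇒m⊓n≡n n≤m) ⟩
  n + (m ∸ n) ⊓ n         ≡⟨ +-distribˡ-⊓ n (m ∸ n) n ⟩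
  (n + (m ∸ n)) ⊓ (n + n) ≡⟨ cong (_⊓ (n + n)) (m+[n∸m]≡n n≤m) ⟩
  m ⊓ (n + n)             ∎
  where open ≡-Reasoning

s≤ᵇs : ∀ m n → (suc m ≤ᵇ suc n) ≡ (m ≤ᵇ n)
s≤ᵇs zero    n = refl
s≤ᵇs (suc m) n = refl

length-filterᵇ-map : ∀ {A B : Set} (P : B → Bool) (f : A → B) (xs : List A) →
                     length (filterᵇ P (map f xs)) ≡ length (filterᵇ (P ∘ f) xs)
length-filterᵇ-map P f []       = refl
length-filterᵇ-map P f (x ∷ xs) with P (f x)
... | true  = cong suc (length-filterᵇ-map P f xs)
... | false = length-filterᵇ-map P f xs

count : ∀ n → (Vertex n → Bool) → ℕ
count n P = length (filterᵇ P (allVertices n))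

count-suc : ∀ n (P : Vertex (suc n) → Bool) →
            count (suc n) P ≡ count n (P ∘ (false ∷_)) + count n (P ∘ (true ∷_))
count-suc n P = begin
  length (filterᵇ P (map (false ∷_) vs ++ map (true ∷_) vs))
    ≡⟨ cong length (filter-++ (T? ∘ P) (map (false ∷_) vs) (map (true ∷_) vs)) ⟩
  length (filterᵇ P (map (false ∷_) vs) ++ filterᵇ P (map (true ∷_) vs))
    ≡⟨ length-++ (filterᵇ P (map (false ∷_) vs)) ⟩
  length (filterᵇ P (map (false ∷_) vs)) + length (filterᵇ P (map (true ∷_) vs))
    ≡⟨ cong₂ _+_ (length-filterᵇ-map P (false ∷_) vs) (length-filterᵇ-map P (true ∷_) vs) ⟩
  count n (P ∘ (false ∷_)) + count n (P ∘ (true ∷_)) ∎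
  where
  open ≡-Reasoning
  vs = allVertices n

count-mono : ∀ n {P Q : Vertex n → Bool} → (∀ u → T (P u) → T (Q u)) → count n P ≤ count n Q
count-mono n {P} {Q} P⇒Q =
  length-mono-≤ (filter⁺ (T? ∘ P) (T? ∘ Q) (λ { refl → P⇒Q _ }) (⊆-refl {x = allVertices n}))

count-cong : ∀ n {P Q : Vertex n → Bool} → (∀ u → P u ≡ Q u) → count n P ≡ count n Q
count-cong n P≗Q = ≤-antisym (count-mono n (λ u → subst T (P≗Q u)))
                             (count-mono n (λ u → subst T (sym (P≗Q u))))

count-face₀ : ∀ n (P : Vertex (suc n) → Bool) → count n (P ∘ (false ∷_)) ≤ count (suc n) P
count-face₀ n P = ≤-trans (m≤m+n _ _) (≤-reflexive (sym (count-suc n P)))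

count-true : ∀ n → count n (λ _ → true) ≡ 2 ^ n
count-true zero    = refl
count-true (suc n) = begin
  count (suc n) (λ _ → true)                    ≡⟨ count-suc n (λ _ → true) ⟩
  count n (λ _ → true) + count n (λ _ → true)   ≡⟨ cong₂ _+_ (count-true n) (count-true n) ⟩
  2 ^ n + 2 ^ n                                 ≡⟨ sym (2^[1+n]≡2^n+2^n n) ⟩
  2 ^ suc n                                     ∎
  where open ≡-Reasoning

count-false : ∀ n → count n (λ _ → false) ≡ 0
count-false zero    = refl
count-false (suc n) = trans (count-suc n (λ _ → false)) (cong₂ _+_ (count-false n) (count-false n))

hamming≡0⇒≡ : ∀ (u v : Vertex n) → hamming u v ≡ 0 → u ≡ v
hamming≡0⇒≡ []          []          _  = refl
hamming≡0⇒≡ (false ∷ u) (false ∷ v) eq = cong (false ∷_) (hamming≡0⇒≡ u v eq)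
hamming≡0⇒≡ (true ∷ u)  (true ∷ v)  eq = cong (true ∷_) (hamming≡0⇒≡ u v eq)

hamming≤n : ∀ (u v : Vertex n) → hamming u v ≤ n
hamming≤n []          []          = z≤n
hamming≤n (false ∷ u) (false ∷ v) = m≤n⇒m≤1+n (hamming≤n u v)
hamming≤n (true ∷ u)  (true ∷ v)  = m≤n⇒m≤1+n (hamming≤n u v)
hamming≤n (false ∷ u) (true ∷ v)  = s≤s (hamming≤n u v)
hamming≤n (true ∷ u)  (false ∷ v) = s≤s (hamming≤n u v)

adjacent-intro : ∀ (u v : Vertex n) → 1 ≤ hamming u v → hamming u v ≤ k → T (adjacent k u v)
adjacent-intro u v 1≤d d≤k = from T-∧ (≤⇒≤ᵇ 1≤d , ≤⇒≤ᵇ d≤k)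

ballSize : ∀ n → ℕ → Vertex n → ℕ
ballSize n j v = count n (λ u → hamming u v ≤ᵇ j)

ballSize-shift : ∀ (v : Vertex n) → count n (λ u → suc (hamming u v) ≤ᵇ suc j) ≡ ballSize n j v
ballSize-shift {n} {j} v = count-cong n (λ u → s≤ᵇs (hamming u v) j)

ballSize-cons : ∀ b (v : Vertex n) →
                ballSize (suc n) (suc j) (b ∷ v) ≡ ballSize n (suc j) v + ballSize n j v
ballSize-cons {n} {j} false v =
  trans (count-suc n _) (cong (ballSize n (suc j) v +_) (ballSize-shift v))
ballSize-cons {n} {j} true v =
  trans (count-suc n _) (trans (cong (_+ ballSize n (suc j) v) (ballSize-shift v))
                               (+-comm (ballSize n j v) (ballSize n (suc j) v)))

ballSize-≤-cons : ∀ b (v : Vertex n) → ballSize n j v ≤ ballSize (suc n) j (b ∷ v)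
ballSize-≤-cons {n} false v = ≤-trans (m≤m+n _ _) (≤-reflexive (sym (count-suc n _)))
ballSize-≤-cons {n} true  v = ≤-trans (m≤n+m _ _) (≤-reflexive (sym (count-suc n _)))

ballSize-mono-radius : ∀ (v : Vertex n) → ballSize n j v ≤ ballSize n (suc j) v
ballSize-mono-radius {n} {j} v =
  count-mono n (λ u d≤j → ≤⇒≤ᵇ (m≤n⇒m≤1+n (≤ᵇ⇒≤ (hamming u v) j d≤j)))

ballSize>0 : ∀ (v : Vertex n) → 0 < ballSize n j v
ballSize>0 []      = s≤s z≤n
ballSize>0 (b ∷ v) = ≤-trans (ballSize>0 v) (ballSize-≤-cons b v)

2^j≤ballSize : ∀ (v : Vertex n) → j ≤ n → 2 ^ j ≤ ballSize n j v
2^j≤ballSize {j = zero}  v       _         = ballSize>0 v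
2^j≤ballSize {j = suc j} (b ∷ v) (s≤s j≤n) = begin
  2 ^ suc j                             ≡⟨ 2^[1+n]≡2^n+2^n j ⟩
  2 ^ j + 2 ^ j                         ≤⟨ +-mono-≤ (≤-trans 2^j≤B (ballSize-mono-radius v)) 2^j≤B ⟩
  ballSize _ (suc j) v + ballSize _ j v ≡⟨ sym (ballSize-cons b v) ⟩
  ballSize _ (suc j) (b ∷ v)            ∎
  where
  open ≤-Reasoning
  2^j≤B = 2^j≤ballSize v j≤n

2^[1+j]+2^j≤ballSize : ∀ (v : Vertex (suc n)) → suc j ≤ n →
                       2 ^ suc j + 2 ^ j ≤ ballSize (suc n) (suc j) v
2^[1+j]+2^j≤ballSize (b ∷ v) 1+j≤n =
  ≤-trans (+-mono-≤ (2^j≤ballSize v 1+j≤n) (2^j≤ballSize v (≤-trans (n≤1+n _) 1+j≤n)))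
          (≤-reflexive (sym (ballSize-cons b v)))

4≤ballSize₃₁ : ∀ (v : Vertex 3) → 4 ≤ ballSize 3 1 v
4≤ballSize₃₁ (b ∷ v) =
  ≤-trans (+-mono-≤ (2^[1+j]+2^j≤ballSize v ≤-refl) (ballSize>0 v))
          (≤-reflexive (sym (ballSize-cons b v)))

ballSize-lift : m ≤′ n → (∀ (v : Vertex m) → r ≤ ballSize m j v) →
                ∀ (v : Vertex n) → r ≤ ballSize n j v
ballSize-lift ≤′-refl        balls v       = balls v
ballSize-lift (≤′-step m≤n) balls (b ∷ v) =
  ≤-trans (ballSize-lift m≤n balls v) (ballSize-≤-cons b v)

ContagiousSetOfSize : ℕ → ℕ → ℕ → ℕ → Set
ContagiousSetOfSize n k r s = ∃ λ (A : VSet n) → Contagious k r A × size A ≡ s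

initialSegment : ∀ n → ℕ → VSet n
initialSegment zero    r []          = 1 ≤ᵇ r
initialSegment (suc n) r (false ∷ u) = initialSegment n r u
initialSegment (suc n) r (true ∷ u)  = initialSegment n (r ∸ 2 ^ n) u

size-initialSegment : ∀ n r → size (initialSegment n r) ≡ r ⊓ 2 ^ n
size-initialSegment zero    zero    = refl
size-initialSegment zero    (suc r) = cong suc (sym (⊓-zeroʳ r))
size-initialSegment (suc n) r       = begin
  size (initialSegment (suc n) r)
    ≡⟨ count-suc n (initialSegment (suc n) r) ⟩
  size (initialSegment n r) + size (initialSegment n (r ∸ 2 ^ n))
    ≡⟨ cong₂ _+_ (size-initialSegment n r) (size-initialSegment n (r ∸ 2 ^ n)) ⟩
  r ⊓ 2 ^ n + (r ∸ 2 ^ n) ⊓ 2 ^ n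
    ≡⟨ m⊓n+[m∸n]⊓n≡m⊓[n+n] r (2 ^ n) ⟩
  r ⊓ (2 ^ n + 2 ^ n)
    ≡⟨ cong (r ⊓_) (sym (2^[1+n]≡2^n+2^n n)) ⟩
  r ⊓ 2 ^ suc n ∎
  where open ≡-Reasoning

pad : VSet n → VSet (suc n)
pad A (false ∷ u) = A u
pad A (true ∷ _)  = false

size-pad : ∀ (A : VSet n) → size (pad A) ≡ size A
size-pad {n} A =
  trans (count-suc n (pad A)) (trans (cong (size A +_) (count-false n)) (+-identityʳ (size A)))

module _ (k r : ℕ) where

  step-inv : ∀ (S : VSet n) v → T (step k r S v) → T (S v) ⊎ r ≤ nbrCount k S v
  step-inv S v = Sum.map₂ (≤ᵇ⇒≤ r _) ∘ to (T-∨ {S v})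

  step-keep : ∀ (S : VSet n) v → T (S v) → T (step k r S v)
  step-keep S v = from T-∨ ∘ inj₁

  step-add : ∀ (S : VSet n) v → r ≤ nbrCount k S v → T (step k r S v)
  step-add S v = from (T-∨ {S v}) ∘ inj₂ ∘ ≤⇒≤ᵇ

  nbrCount≤size : ∀ (S : VSet n) v → nbrCount k S v ≤ size S
  nbrCount≤size {n} S v = count-mono n (λ u → proj₂ ∘ to T-∧)

  stage-⊆-seed : ∀ (A : VSet n) → size A < r → ∀ i v → T (stage k r A i v) → T (A v)
  stage-⊆-seed A small zero    v p = p
  stage-⊆-seed A small (suc i) v p with step-inv (stage k r A i) v p
  ... | inj₁ q   = stage-⊆-seed A small i v q
  ... | inj₂ r≤N = contradiction small (≤⇒≯ (begin
    r                            ≤⟨ r≤N ⟩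
    nbrCount k (stage k r A i) v ≤⟨ nbrCount≤size (stage k r A i) v ⟩
    size (stage k r A i)         ≤⟨ count-mono _ (stage-⊆-seed A small i) ⟩
    size A                       ∎))
    where open ≤-Reasoning

  r≤size-of-contagious : ∀ (A : VSet n) → r ≤ n → Contagious k r A → r ≤ size A
  r≤size-of-contagious {n} A r≤n (i , full) = ≮⇒≥ λ small → <-irrefl refl (begin-strict
    2 ^ n                 ≡⟨ sym (count-true n) ⟩
    count n (λ _ → true)  ≤⟨ count-mono n (λ v _ → stage-⊆-seed A small i v (from T-≡ (full v))) ⟩
    size A                <⟨ small ⟩
    r                     ≤⟨ r≤n ⟩
    n                     <⟨ n<2^n n ⟩
    2 ^ n                 ∎)
    where open ≤-Reasoning

  contagious-complete : ∀ (A : VSet n) → n ≤ k → r ≤ size A → Contagious k r A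
  contagious-complete {n} A n≤k r≤|A| = 1 , λ v → to T-≡ (infected v)
    where
    infected : ∀ v → T (step k r A v)
    infected v with T? (A v)
    ... | yes Av  = step-keep A v Av
    ... | no  ¬Av = step-add A v (≤-trans r≤|A| (count-mono n adj))
      where
      adj : ∀ u → T (A u) → T (adjacent k u v ∧ A u)
      adj u Au = from T-∧ (adjacent-intro u v 1≤d (≤-trans (hamming≤n u v) n≤k) , Au)
        where
        1≤d : 1 ≤ hamming u v
        1≤d = n≢0⇒n>0 λ d≡0 → ¬Av (subst (T ∘ A) (hamming≡0⇒≡ u v d≡0) Au)

  nbrCount-pad : ∀ (S : VSet n) (S′ : VSet (suc n)) u → (∀ w → T (S w) → T (S′ (false ∷ w))) →
                 nbrCount k S u ≤ nbrCount k S′ (false ∷ u)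
  nbrCount-pad {n} S S′ u S⊆S′ =
    ≤-trans (count-mono n (λ w → from T-∧ ∘ Product.map₂ (S⊆S′ w) ∘ to T-∧)) (count-face₀ n _)

  stage-pad : ∀ (A : VSet n) i u → T (stage k r A i u) → T (stage k r (pad A) i (false ∷ u))
  stage-pad A zero    u p = p
  stage-pad A (suc i) u p with step-inv (stage k r A i) u p
  ... | inj₁ q   = step-keep (stage k r (pad A) i) (false ∷ u) (stage-pad A i u q)
  ... | inj₂ r≤N = step-add (stage k r (pad A) i) (false ∷ u)
    (≤-trans r≤N (nbrCount-pad (stage k r A i) (stage k r (pad A) i) u (stage-pad A i)))

ballSize≤nbrCount-face₁ : ∀ (S : VSet (suc n)) u → (∀ w → T (S (false ∷ w))) →
                          ballSize n j u ≤ nbrCount (suc j) S (true ∷ u)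
ballSize≤nbrCount-face₁ {n} {j} S u face₀ = ≤-trans (count-mono n adj) (count-face₀ n _)
  where
  adj : ∀ w → T (hamming w u ≤ᵇ j) → T (adjacent (suc j) (false ∷ w) (true ∷ u) ∧ S (false ∷ w))
  adj w d≤j =
    from T-∧ (adjacent-intro (false ∷ w) (true ∷ u) (s≤s z≤n) (s≤s (≤ᵇ⇒≤ _ j d≤j)) , face₀ w)

extend : (∀ v → r ≤ ballSize m j v) →
         ContagiousSetOfSize m (suc j) r s → ContagiousSetOfSize (suc m) (suc j) r s
extend {r} {m} {j} balls (A , (i , full) , |A|≡s) =
  pad A , (suc i , to T-≡ ∘ infected) , trans (size-pad A) |A|≡s
  where
  Aᵢ = stage (suc j) r (pad A) i
  face₀ : ∀ w → T (Aᵢ (false ∷ w))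
  face₀ w = stage-pad (suc j) r A i w (from T-≡ (full w))
  infected : ∀ v → T (stage (suc j) r (pad A) (suc i) v)
  infected (false ∷ w) = step-keep (suc j) r Aᵢ (false ∷ w) (face₀ w)
  infected (true ∷ u)  =
    step-add (suc j) r Aᵢ (true ∷ u) (≤-trans (balls u) (ballSize≤nbrCount-face₁ Aᵢ u face₀))

extend* : m ≤′ n → (∀ v → r ≤ ballSize m j v) →
          ContagiousSetOfSize m (suc j) r s → ContagiousSetOfSize n (suc j) r s
extend* ≤′-refl        _     C = C
extend* (≤′-step m≤n) balls C = extend (ballSize-lift m≤n balls) (extend* m≤n balls C)

contagiousSet-complete : n ≤ k → r ≤ 2 ^ n → ContagiousSetOfSize n k r r
contagiousSet-complete {n} {k} {r} n≤k r≤2^n =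
  initialSegment n r , contagious-complete k r _ n≤k (≤-reflexive (sym |I|≡r)) , |I|≡r
  where
  |I|≡r : size (initialSegment n r) ≡ r
  |I|≡r = trans (size-initialSegment n r) (m≤n⇒m⊓n≡m r≤2^n)

contagiousSet-from-complete : r ≤ n → r ≤ 2 ^ suc j + 2 ^ j → ContagiousSetOfSize n (2 + j) r r
contagiousSet-from-complete {r} {n} {j} r≤n r≤B with ≤-total n (2 + j)
... | inj₁ n≤k = contagiousSet-complete n≤k (≤-trans r≤n (<⇒≤ (n<2^n n)))
... | inj₂ k≤n = extend* (≤⇒≤′ k≤n) (λ v → ≤-trans r≤B (2^[1+j]+2^j≤ballSize v ≤-refl))
                         (contagiousSet-complete ≤-refl r≤2^k)
  where
  r≤2^k : r ≤ 2 ^ (2 + j)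
  r≤2^k = begin
    r                         ≤⟨ r≤B ⟩
    2 ^ suc j + 2 ^ j         ≤⟨ +-monoʳ-≤ (2 ^ suc j) (^-monoʳ-≤ 2 (n≤1+n j)) ⟩
    2 ^ suc j + 2 ^ suc j     ≡⟨ sym (2^[1+n]≡2^n+2^n (suc j)) ⟩
    2 ^ (2 + j)               ∎
    where open ≤-Reasoning

-- The opposite edges {00x} and {11x} of the 3-cube: every other vertex is within distance 2
-- of all four of their points.
seed₃ : VSet 3
seed₃ (a ∷ b ∷ _ ∷ []) = not (a xor b)

seed₃-contagious : Contagious 2 4 seed₃
seed₃-contagious = 1 , λ
  { (false ∷ false ∷ false ∷ []) → refl ; (false ∷ false ∷ true ∷ []) → refl
  ; (false ∷ true  ∷ false ∷ []) → refl ; (false ∷ true  ∷ true ∷ []) → refl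
  ; (true  ∷ false ∷ false ∷ []) → refl ; (true  ∷ false ∷ true ∷ []) → refl
  ; (true  ∷ true  ∷ false ∷ []) → refl ; (true  ∷ true  ∷ true ∷ []) → refl }

contagiousSet-exists : ∀ n j r → r ≤ n → r ≤ 2 * (2 + j) → ContagiousSetOfSize n (2 + j) r r
contagiousSet-exists n zero r r≤n r≤4 with m≤n⇒m<n∨m≡n r≤4
... | inj₁ r<4  = contagiousSet-from-complete r≤n (≤-pred r<4)
... | inj₂ refl =
  extend* (≤⇒≤′ (≤-trans (n≤1+n 3) r≤n)) 4≤ballSize₃₁ (seed₃ , seed₃-contagious , refl)
contagiousSet-exists n (suc j) r r≤n r≤2k =
  contagiousSet-from-complete r≤n (≤-trans r≤2k (2k≤2^[k-1]+2^[k-2] j))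

lemma4p2 : ∀ (n k r : ℕ) → 2 ≤ k → r ≤ n → 2 ≤ r → r ≤ 2 * k
    → MinContagiousSize n k r r
lemma4p2 n (suc (suc j)) r (s≤s (s≤s _)) r≤n _ r≤2k =
  contagiousSet-exists n j r r≤n r≤2k , λ A → r≤size-of-contagious _ r A r≤n
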